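{- The line graph $L(P)$ of the Petersen graph $P$ is vertex-transitive, but not uniformly vertex-transitive.
   Context: The Petersen graph has as vertices the 2-element subsets of $\{1,2,3,4,5\}$, two being adjacent iff disjoint. The line graph $L(\Gamma)$ has vertex set $E(\Gamma)$, two edges adjacent iff they share a vertex. A graph is vertex-transitive if its automorphism group acts transitively on its vertices. Automorphisms of a graph on $n$ vertices are identified with $n\times n$ permutation matrices (entry $(u,v)$ equals $1$ iff $\sigma(u)=v$); $J_n$ is the all-ones $n\times n$ matrix. A graph $\Gamma$ on $n$ vertices is uniformly vertex-transitive if there is a subset $\{\sigma_1,\ldots,\sigma_n\}\subset\mathrm{Aut}(\Gamma)$ of size $n$ with $\sum_i\sigma_i=J_n$. -}

module Defs where

open import Data.Nat using (ℕ; zero; suc; _+_)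
open import Data.Bool using (Bool; true; false; _∧_; _∨_; not; if_then_else_)
open import Data.Fin using (Fin; zero; suc)
open import Data.Fin.Properties using (_≟_)
open import Data.Fin.Permutation using (Permutation′; _⟨$⟩ʳ_)
open import Data.List using (List; []; _∷_; length; filterᵇ; concatMap; map; lookup; allFin)
open import Data.Product using (_×_; _,_; proj₁; proj₂; ∃; Σ)
open import Relation.Nullary.Decidable using (⌊_⌋)
open import Relation.Binary.PropositionalEquality using (_≡_)
open import Data.Fin using (_<?_)

-- A finite simple graph on vertex set Fin n, adjacency given as a Boolean
-- relation (assumed symmetric and irreflexive for the graphs built below).
record Graph : Set where
  field
    n   : ℕ
    adj : Fin n → Fin n → Bool
open Graph public

_==_ : ∀ {k} → Fin k → Fin k → Bool
a == b = ⌊ a ≟ b ⌋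

pairsLt : (k : ℕ) → List (Fin k × Fin k)
pairsLt k = concatMap (λ a → map (λ b → (a , b)) (filterᵇ (λ b → ⌊ a <? b ⌋) (allFin k))) (allFin k)

-- Petersen graph: vertices are the 2-element subsets {a,b} of a 5-element
-- set (here Fin 5, encoded as a < b), adjacent iff disjoint.

petersenVerts : List (Fin 5 × Fin 5)
petersenVerts = pairsLt 5

disjoint : (Fin 5 × Fin 5) → (Fin 5 × Fin 5) → Bool
disjoint (a , b) (c , d) = not (a == c ∨ a == d ∨ b == c ∨ b == d)

Petersen : Graph
Petersen = record
  { n   = length petersenVerts
  ; adj = λ u v → disjoint (lookup petersenVerts u) (lookup petersenVerts v)
  }

edges : (Γ : Graph) → List (Fin (n Γ) × Fin (n Γ))
edges Γ = filterᵇ (λ e → adj Γ (proj₁ e) (proj₂ e)) (pairsLt (n Γ))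

shareVertex : ∀ {k} → (Fin k × Fin k) → (Fin k × Fin k) → Bool
shareVertex (a , b) (c , d) = a == c ∨ a == d ∨ b == c ∨ b == d

LineGraph : Graph → Graph
LineGraph Γ = record
  { n   = length (edges Γ)
  ; adj = λ e f → not (e == f) ∧ shareVertex (lookup (edges Γ) e) (lookup (edges Γ) f)
  }

IsAut : (Γ : Graph) → Permutation′ (n Γ) → Set
IsAut Γ σ = ∀ u v → adj Γ (σ ⟨$⟩ʳ u) (σ ⟨$⟩ʳ v) ≡ adj Γ u v

Aut : Graph → Set
Aut Γ = Σ (Permutation′ (n Γ)) (IsAut Γ)

VertexTransitive : Graph → Set
VertexTransitive Γ = ∀ (u v : Fin (n Γ)) → Σ (Aut Γ) λ σ → proj₁ σ ⟨$⟩ʳ u ≡ v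

permMatrix : ∀ {k} → Permutation′ k → Fin k → Fin k → ℕ
permMatrix σ u v = if (σ ⟨$⟩ʳ u) == v then 1 else 0

∑ : ∀ k → (Fin k → ℕ) → ℕ
∑ zero    f = 0
∑ (suc k) f = f zero + ∑ k (λ i → f (suc i))

UniformlyVertexTransitive : Graph → Set
UniformlyVertexTransitive Γ =
  Σ (Fin (n Γ) → Aut Γ) λ σ →
    (∀ i j → (∀ x → proj₁ (σ i) ⟨$⟩ʳ x ≡ proj₁ (σ j) ⟨$⟩ʳ x) → i ≡ j)
    × (∀ u v → ∑ (n Γ) (λ i → permMatrix (proj₁ (σ i)) u v) ≡ 1)

module Submission where

-- A bijection f of the vertices of a graph Γ that sends
-- edges to edges induces an automorphism of L(Γ), since adjacency in L(Γ) only
-- asks whether two edges share an endpoint (lineGraph-aut).  Every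
-- permutation π of {0,…,4} acts on the 2-subsets, i.e. on V(P), and on E(P);
-- for each edge {ab}–{cd} of P the permutation 0,1,2,3,4 ↦ a,b,c,d,(rest)
-- sends the base edge {01}–{23} to it.  Hence every vertex of L is the image
-- of the base vertex under an automorphism, which suffices
-- (vertexTransitive-from-base).
--
-- Non-uniformity: a parity argument.  If permutation matrices σ₁,…,σₙ sum to
-- J, then every weight c on the vertices satisfies ∑ᵢ c(σᵢ u) = ∑ᵥ c(v)
-- (uniform-average).  Summing the weight of the images σᵢ(T) of a triangle T
-- therefore gives 3·∑ c; so if every triangle has even weight, ∑ c is even
-- (triangle-parity-obstruction).  In L the triangles are the stars of the
-- vertices of P, and the edges of a pentagon of P give a weight of total 5
-- meeting every star in 0 or 2 edges.

open import Defs
open import Data.Bool using (Bool; true; false; _∧_; _∨_; not; if_then_else_)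
import Data.Bool.Properties as Bool
open import Data.Fin using (Fin; zero; suc; #_)
open import Data.Fin.Properties using (_≟_; all?; suc-injective)
open import Data.Fin.Permutation using (Permutation′; _⟨$⟩ʳ_; _⟨$⟩ˡ_; permutation; flip; _∘ₚ_; inverseˡ; inverseʳ)
open import Data.List using (List; []; _∷_; length; lookup; allFin; findᵇ; findIndexᵇ)
open import Data.Bool.ListAction using (any)
open import Data.Maybe using (fromMaybe)
open import Data.Nat using (ℕ; zero; suc; _+_; _*_)
open import Data.Nat.Divisibility using (_∣_; _∣?_; _∣0; ∣m∣n⇒∣m+n; ∣m+n∣m⇒∣n; m∣m*n)
open import Data.Nat.Properties using (+-identityʳ; *-identityʳ; *-zeroʳ; +-*-semiring)
open import Data.Product using (_×_; _,_; proj₁; proj₂; Σ; map; swap)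
open import Data.Product.Properties using (≡-dec)
open import Data.Sum using (_⊎_; inj₁; inj₂)
import Data.Vec as Vec
open import Data.Vec.Functional using (Vector)
open import Function using (_∘_)
open import Relation.Nullary using (¬_; Dec; yes; no)
open import Relation.Nullary.Decidable using (isYes≗does; dec-true; dec-false; from-yes; from-no; _⊎-dec_; _→-dec_)
open import Relation.Binary.PropositionalEquality
open import Algebra.Properties.Semiring.Sum +-*-semiring using (sum; sum-cong-≗; sum-replicate-zero; ∑-distrib-+; ∑-comm; *-distribˡ-sum)

∑≡sum : ∀ k (f : Fin k → ℕ) → ∑ k f ≡ sum f
∑≡sum zero    f = refl
∑≡sum (suc k) f = cong (f zero +_) (∑≡sum k (f ∘ suc))

∣-sum : ∀ {d k} (f : Vector ℕ k) → (∀ i → d ∣ f i) → d ∣ sum f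
∣-sum {d} {zero} f d∣f = d ∣0
∣-sum {d} {suc k} f d∣f = ∣m∣n⇒∣m+n (d∣f zero) (∣-sum (f ∘ suc) (d∣f ∘ suc))

==-true : ∀ {k} {a b : Fin k} → a ≡ b → (a == b) ≡ true
==-true {a = a} {b} a≡b = trans (isYes≗does (a ≟ b)) (dec-true (a ≟ b) a≡b)

==-false : ∀ {k} {a b : Fin k} → a ≢ b → (a == b) ≡ false
==-false {a = a} {b} a≢b = trans (isYes≗does (a ≟ b)) (dec-false (a ≟ b) a≢b)

leftInverse⇒injective : ∀ {A B : Set} (f : A → B) (g : B → A) → (∀ x → g (f x) ≡ x) →
                        ∀ {a b} → f a ≡ f b → a ≡ b
leftInverse⇒injective f g g∘f≡id {a} {b} fa≡fb = begin
  a       ≡⟨ g∘f≡id a ⟨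
  g (f a) ≡⟨ cong g fa≡fb ⟩
  g (f b) ≡⟨ g∘f≡id b ⟩
  b       ∎
  where open ≡-Reasoning

==-injective : ∀ {k l} (f : Fin k → Fin l) → (∀ {a b} → f a ≡ f b → a ≡ b) →
               ∀ a b → (f a == f b) ≡ (a == b)
==-injective f f-inj a b with a ≟ b
... | yes a≡b = ==-true (cong f a≡b)
... | no  a≢b = ==-false (a≢b ∘ f-inj)

δ : ∀ {k} → Fin k → Fin k → ℕ
δ w v = if w == v then 1 else 0

δ-refl : ∀ {k} (w : Fin k) → δ w w ≡ 1
δ-refl w = cong (if_then 1 else 0) (==-true {a = w} refl)

δ-≢ : ∀ {k} (w v : Fin k) → w ≢ v → δ w v ≡ 0
δ-≢ w v w≢v = cong (if_then 1 else 0) (==-false w≢v)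

δ-suc : ∀ {k} (w v : Fin k) → δ (suc w) (suc v) ≡ δ w v
δ-suc w v = cong (if_then 1 else 0) (==-injective suc suc-injective w v)

sum-select : ∀ {k} (c : Vector ℕ k) (w : Fin k) → sum (λ v → c v * δ w v) ≡ c w
sum-select {suc k} c zero = begin
  c zero * δ {suc k} zero zero + sum (λ v → c (suc v) * δ zero (suc v))
    ≡⟨ cong₂ _+_ (cong (c zero *_) (δ-refl (zero {k}))) (sum-cong-≗ λ v → cong (c (suc v) *_) (δ-≢ zero (suc v) λ ())) ⟩
  c zero * 1 + sum (λ v → c (suc v) * 0)
    ≡⟨ cong₂ _+_ (*-identityʳ (c zero)) (trans (sum-cong-≗ (*-zeroʳ ∘ c ∘ suc)) (sum-replicate-zero k)) ⟩
  c zero + 0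
    ≡⟨ +-identityʳ (c zero) ⟩
  c zero ∎
  where open ≡-Reasoning
sum-select {suc k} c (suc w) = begin
  c zero * δ (suc w) zero + sum (λ v → c (suc v) * δ (suc w) (suc v))
    ≡⟨ cong₂ _+_ (cong (c zero *_) (δ-≢ (suc w) zero λ ())) (sum-cong-≗ λ v → cong (c (suc v) *_) (δ-suc w v)) ⟩
  c zero * 0 + sum (λ v → c (suc v) * δ w v)
    ≡⟨ cong₂ _+_ (*-zeroʳ (c zero)) (sum-select (c ∘ suc) w) ⟩
  c (suc w) ∎
  where open ≡-Reasoning

-- If the permutation matrices of
-- σ₁,…,σₘ sum to J, every vertex u is sent to each vertex exactly once, so
-- the σᵢ-images of u carry, in total, the weight of the whole vertex set.
uniform-average : ∀ {k m} (σ : Fin m → Permutation′ k) →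
                  (∀ u v → ∑ m (λ i → permMatrix (σ i) u v) ≡ 1) →
                  (c : Vector ℕ k) (u : Fin k) → sum (λ i → c (σ i ⟨$⟩ʳ u)) ≡ sum c
uniform-average {m = m} σ uniform c u = begin
  sum (λ i → c (σ i ⟨$⟩ʳ u))
    ≡⟨ sum-cong-≗ (λ i → sym (sum-select c (σ i ⟨$⟩ʳ u))) ⟩
  sum (λ i → sum (λ v → c v * permMatrix (σ i) u v))
    ≡⟨ ∑-comm (λ i v → c v * permMatrix (σ i) u v) ⟩
  sum (λ v → sum (λ i → c v * permMatrix (σ i) u v))
    ≡⟨ sum-cong-≗ (λ v → sym (*-distribˡ-sum (c v) (λ i → permMatrix (σ i) u v))) ⟩
  sum (λ v → c v * sum (λ i → permMatrix (σ i) u v))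
    ≡⟨ sum-cong-≗ (λ v → cong (c v *_) (trans (sym (∑≡sum m _)) (uniform u v))) ⟩
  sum (λ v → c v * 1)
    ≡⟨ sum-cong-≗ (*-identityʳ ∘ c) ⟩
  sum c ∎
  where open ≡-Reasoning

Triangle : (Γ : Graph) → Fin (n Γ) → Fin (n Γ) → Fin (n Γ) → Set
Triangle Γ x y z = adj Γ x y ≡ true × adj Γ y z ≡ true × adj Γ x z ≡ true

aut-triangle : ∀ (Γ : Graph) (σ : Aut Γ) {x y z} → Triangle Γ x y z →
               let s = proj₁ σ ⟨$⟩ʳ_ in Triangle Γ (s x) (s y) (s z)
aut-triangle Γ (σ , σ-aut) {x} {y} {z} (xy , yz , xz) =
  trans (σ-aut x y) xy , trans (σ-aut y z) yz , trans (σ-aut x z) xz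

-- If a graph has a triangle, every triangle has
-- even weight, and the total weight is odd, the graph is not uniformly
-- vertex-transitive: the σᵢ-images of a triangle x y z have even weights
-- summing to 3 · ∑ c.
triangle-parity-obstruction :
  (Γ : Graph) (c : Vector ℕ (n Γ)) →
  (∀ x y z → Triangle Γ x y z → 2 ∣ c x + c y + c z) →
  ¬ 2 ∣ sum c →
  ∀ x y z → Triangle Γ x y z → ¬ UniformlyVertexTransitive Γ
triangle-parity-obstruction Γ c even-triangles odd-total x y z xyz (σ , _ , uniform) =
  odd-total (∣m+n∣m⇒∣n three-copies-even two-copies-even)
  where
  total = sum c
  image : Fin (n Γ) → Fin (n Γ) → Fin (n Γ)
  image i = proj₁ (σ i) ⟨$⟩ʳ_
  average : ∀ u → sum (λ i → c (image i u)) ≡ total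
  average = uniform-average (proj₁ ∘ σ) uniform c
  images-weight : sum (λ i → c (image i x) + c (image i y) + c (image i z)) ≡ total + total + total
  images-weight = begin
    sum (λ i → c (image i x) + c (image i y) + c (image i z))
      ≡⟨ ∑-distrib-+ (λ i → c (image i x) + c (image i y)) (λ i → c (image i z)) ⟩
    sum (λ i → c (image i x) + c (image i y)) + sum (λ i → c (image i z))
      ≡⟨ cong (_+ sum (λ i → c (image i z))) (∑-distrib-+ (λ i → c (image i x)) (λ i → c (image i y))) ⟩
    sum (λ i → c (image i x)) + sum (λ i → c (image i y)) + sum (λ i → c (image i z))
      ≡⟨ cong₂ _+_ (cong₂ _+_ (average x) (average y)) (average z) ⟩
    total + total + total ∎
    where open ≡-Reasoning
  two-copies-even : 2 ∣ total + total
  two-copies-even = subst (2 ∣_) (cong (total +_) (+-identityʳ total)) (m∣m*n total)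
  three-copies-even : 2 ∣ total + total + total
  three-copies-even = subst (2 ∣_) images-weight
    (∣-sum _ λ i → even-triangles _ _ _ (aut-triangle Γ (σ i) xyz))

aut-inverse : (Γ : Graph) → Aut Γ → Aut Γ
aut-inverse Γ (π , π-aut) = flip π , λ x y →
  trans (sym (π-aut (π ⟨$⟩ˡ x) (π ⟨$⟩ˡ y))) (cong₂ (adj Γ) (inverseʳ π) (inverseʳ π))

aut-compose : (Γ : Graph) → Aut Γ → Aut Γ → Aut Γ
aut-compose Γ (π , π-aut) (ρ , ρ-aut) = π ∘ₚ ρ , λ x y → trans (ρ-aut (π ⟨$⟩ʳ x) (π ⟨$⟩ʳ y)) (π-aut x y)

-- A graph is vertex-transitive as soon as one base vertex can be moved to
-- every vertex: to move u to v, go back from u to the base, then on to v.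
vertexTransitive-from-base : (Γ : Graph) (base : Fin (n Γ)) →
  (∀ v → Σ (Aut Γ) λ σ → proj₁ σ ⟨$⟩ʳ base ≡ v) → VertexTransitive Γ
vertexTransitive-from-base Γ base reach u v =
  aut-compose Γ (aut-inverse Γ σᵤ) σᵥ , (begin
    proj₁ σᵥ ⟨$⟩ʳ (proj₁ σᵤ ⟨$⟩ˡ u)                     ≡⟨ cong (λ w → proj₁ σᵥ ⟨$⟩ʳ (proj₁ σᵤ ⟨$⟩ˡ w)) (sym σᵤbase) ⟩
    proj₁ σᵥ ⟨$⟩ʳ (proj₁ σᵤ ⟨$⟩ˡ (proj₁ σᵤ ⟨$⟩ʳ base)) ≡⟨ cong (proj₁ σᵥ ⟨$⟩ʳ_) (inverseˡ (proj₁ σᵤ)) ⟩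
    proj₁ σᵥ ⟨$⟩ʳ base                                 ≡⟨ σᵥbase ⟩
    v ∎)
  where
  open ≡-Reasoning
  σᵤ = proj₁ (reach u)
  σᵤbase = proj₂ (reach u)
  σᵥ = proj₁ (reach v)
  σᵥbase = proj₂ (reach v)

_≈ₑ_ : ∀ {k} → Fin k × Fin k → Fin k × Fin k → Set
p ≈ₑ q = p ≡ q ⊎ p ≡ swap q

-- Two rearrangements of a four-fold disjunction, matching the two ways of
-- reversing an edge in shareVertex.
∨-swap-pairs : ∀ w x y z → w ∨ x ∨ y ∨ z ≡ y ∨ z ∨ w ∨ x
∨-swap-pairs w x y z =
  trans (sym (Bool.∨-assoc w x (y ∨ z))) (trans (Bool.∨-comm (w ∨ x) (y ∨ z)) (Bool.∨-assoc y z (w ∨ x)))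

∨-swap-each : ∀ w x y z → w ∨ x ∨ y ∨ z ≡ x ∨ w ∨ z ∨ y
∨-swap-each false false y z = Bool.∨-comm y z
∨-swap-each false true  y z = refl
∨-swap-each true  false y z = refl
∨-swap-each true  true  y z = refl

shareVertex-≈ₑ : ∀ {k} {p p′ q q′ : Fin k × Fin k} → p ≈ₑ p′ → q ≈ₑ q′ → shareVertex p q ≡ shareVertex p′ q′
shareVertex-≈ₑ {p′ = a , b} {q′ = c , d} p≈ q≈ = trans (flip-left p≈) (flip-right q≈)
  where
  flip-left : ∀ {p q} → p ≈ₑ (a , b) → shareVertex p q ≡ shareVertex (a , b) q
  flip-left (inj₁ refl) = refl
  flip-left {q = c′ , d′} (inj₂ refl) =
    ∨-swap-pairs (b == c′) (b == d′) (a == c′) (a == d′)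
  flip-right : ∀ {q} → q ≈ₑ (c , d) → shareVertex (a , b) q ≡ shareVertex (a , b) (c , d)
  flip-right (inj₁ refl) = refl
  flip-right (inj₂ refl) = ∨-swap-each (a == d) (a == c) (b == d) (b == c)

shareVertex-injective : ∀ {k} (f : Fin k → Fin k) → (∀ {a b} → f a ≡ f b → a ≡ b) →
  ∀ p q → shareVertex (map f f p) (map f f q) ≡ shareVertex p q
shareVertex-injective f f-inj (a , b) (c , d)
  rewrite ==-injective f f-inj a c | ==-injective f f-inj a d
        | ==-injective f f-inj b c | ==-injective f f-inj b d = refl

endpoints : (Γ : Graph) → Fin (n (LineGraph Γ)) → Fin (n Γ) × Fin (n Γ)
endpoints Γ = lookup (edges Γ)

lineGraph-aut : (Γ : Graph) (g : Permutation′ (n (LineGraph Γ))) (f : Fin (n Γ) → Fin (n Γ)) →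
  (∀ {a b} → f a ≡ f b → a ≡ b) →
  (∀ e → endpoints Γ (g ⟨$⟩ʳ e) ≈ₑ map f f (endpoints Γ e)) →
  IsAut (LineGraph Γ) g
lineGraph-aut Γ g f f-inj g-endpoints e e′ =
  cong₂ (λ same share → not same ∧ share) (==-injective (g ⟨$⟩ʳ_) g-inj e e′) (begin
    shareVertex (endpoints Γ (g ⟨$⟩ʳ e)) (endpoints Γ (g ⟨$⟩ʳ e′))
      ≡⟨ shareVertex-≈ₑ (g-endpoints e) (g-endpoints e′) ⟩
    shareVertex (map f f (endpoints Γ e)) (map f f (endpoints Γ e′))
      ≡⟨ shareVertex-injective f f-inj (endpoints Γ e) (endpoints Γ e′) ⟩
    shareVertex (endpoints Γ e) (endpoints Γ e′) ∎)
  where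
  open ≡-Reasoning
  g-inj : ∀ {a b} → g ⟨$⟩ʳ a ≡ g ⟨$⟩ʳ b → a ≡ b
  g-inj = leftInverse⇒injective (g ⟨$⟩ʳ_) (g ⟨$⟩ˡ_) (λ _ → inverseˡ g)

-- Unordered equality of pairs, the position of an unordered
-- pair in a list (with a default for absent pairs), and the inverse of a map
-- on Fin k found by search (meaningful when the map is a bijection).
_≐ₑ_ : ∀ {k} → Fin k × Fin k → Fin k × Fin k → Bool
(a , b) ≐ₑ (c , d) = (a == c ∧ b == d) ∨ (a == d ∧ b == c)

indexOf : ∀ {k} (xs : List (Fin k × Fin k)) → Fin (length xs) → Fin k × Fin k → Fin (length xs)
indexOf xs default p = fromMaybe default (findIndexᵇ (_≐ₑ p) xs)

invert : ∀ {k} → (Fin k → Fin k) → Fin k → Fin k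
invert π y = fromMaybe y (findᵇ (λ x → π x == y) (allFin _))

_≈ₑ?_ : ∀ {k} (p q : Fin k × Fin k) → Dec (p ≈ₑ q)
p ≈ₑ? q = ≡-dec _≟_ _≟_ p q ⊎-dec ≡-dec _≟_ _≟_ p (swap q)

L : Graph
L = LineGraph Petersen

-- This list is
-- edges Petersen written out (ends-correct holds by computation), so that
-- the finite checks below need not recompute the edge list.
petersenEdges : List (Fin 10 × Fin 10)
petersenEdges =
  ( (# 0 , # 7) ∷ (# 0 , # 8) ∷ (# 0 , # 9) ∷ (# 1 , # 5) ∷ (# 1 , # 6)
  ∷ (# 1 , # 9) ∷ (# 2 , # 4) ∷ (# 2 , # 6) ∷ (# 2 , # 8) ∷ (# 3 , # 4)
  ∷ (# 3 , # 5) ∷ (# 3 , # 7) ∷ (# 4 , # 9) ∷ (# 5 , # 8) ∷ (# 6 , # 7) ∷ [])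

ends : Fin 15 → Fin 10 × Fin 10
ends = lookup petersenEdges

ends-correct : ∀ e → endpoints Petersen e ≡ ends e
ends-correct e = refl

liftVertex : (Fin 5 → Fin 5) → Fin 10 → Fin 10
liftVertex π i = indexOf petersenVerts i (map π π (lookup petersenVerts i))

liftEdge : (Fin 5 → Fin 5) → Fin 15 → Fin 15
liftEdge π e = indexOf petersenEdges e (map (liftVertex π) (liftVertex π) (ends e))

-- For the edge e = {ab}–{cd} of P, the permutation 0,1,2,3,4 ↦ a,b,c,d,r
-- (r the remaining element); it sends the base edge {01}–{23} to e.
toEdge : Fin 15 → Fin 5 → Fin 5
toEdge e = Vec.lookup (a Vec.∷ b Vec.∷ c Vec.∷ d Vec.∷ r Vec.∷ Vec.[])
  where
  ab = lookup petersenVerts (proj₁ (ends e))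
  cd = lookup petersenVerts (proj₂ (ends e))
  a = proj₁ ab
  b = proj₂ ab
  c = proj₁ cd
  d = proj₂ cd
  r = fromMaybe a (findᵇ (λ x → not (x == a ∨ x == b ∨ x == c ∨ x == d)) (allFin 5))

toEdge-base : ∀ e → liftEdge (toEdge e) zero ≡ e
toEdge-base = from-yes (all? λ e → liftEdge (toEdge e) zero ≟ e)

liftVertex-inverseˡ : ∀ e a → liftVertex (invert (toEdge e)) (liftVertex (toEdge e) a) ≡ a
liftVertex-inverseˡ = from-yes (all? λ e → all? λ a →
  liftVertex (invert (toEdge e)) (liftVertex (toEdge e) a) ≟ a)

liftEdge-inverseˡ : ∀ e x → liftEdge (invert (toEdge e)) (liftEdge (toEdge e) x) ≡ x
liftEdge-inverseˡ = from-yes (all? λ e → all? λ x →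
  liftEdge (invert (toEdge e)) (liftEdge (toEdge e) x) ≟ x)

liftEdge-inverseʳ : ∀ e x → liftEdge (toEdge e) (liftEdge (invert (toEdge e)) x) ≡ x
liftEdge-inverseʳ = from-yes (all? λ e → all? λ x →
  liftEdge (toEdge e) (liftEdge (invert (toEdge e)) x) ≟ x)

liftEdge-endpoints : ∀ e x → ends (liftEdge (toEdge e) x) ≈ₑ map (liftVertex (toEdge e)) (liftVertex (toEdge e)) (ends x)
liftEdge-endpoints = from-yes (all? λ e → all? λ x →
  ends (liftEdge (toEdge e) x) ≈ₑ? map (liftVertex (toEdge e)) (liftVertex (toEdge e)) (ends x))

toEdge-perm : Fin 15 → Permutation′ (n L)
toEdge-perm e = permutation (liftEdge (toEdge e)) (liftEdge (invert (toEdge e)))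
  (liftEdge-inverseʳ e) (liftEdge-inverseˡ e)

liftVertex-injective : ∀ e {a b} → liftVertex (toEdge e) a ≡ liftVertex (toEdge e) b → a ≡ b
liftVertex-injective e =
  leftInverse⇒injective (liftVertex (toEdge e)) (liftVertex (invert (toEdge e))) (liftVertex-inverseˡ e)

toEdge-perm-endpoints : ∀ e x → endpoints Petersen (toEdge-perm e ⟨$⟩ʳ x)
                              ≈ₑ map (liftVertex (toEdge e)) (liftVertex (toEdge e)) (endpoints Petersen x)
toEdge-perm-endpoints e x = subst₂ _≈ₑ_ (sym (ends-correct (liftEdge (toEdge e) x)))
  (cong (map (liftVertex (toEdge e)) (liftVertex (toEdge e))) (sym (ends-correct x)))
  (liftEdge-endpoints e x)

toEdge-aut : Fin 15 → Aut L
toEdge-aut e = toEdge-perm e ,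
  lineGraph-aut Petersen (toEdge-perm e) (liftVertex (toEdge e)) (liftVertex-injective e) (toEdge-perm-endpoints e)

L-vertexTransitive : VertexTransitive L
L-vertexTransitive = vertexTransitive-from-base L zero λ e → toEdge-aut e , toEdge-base e

-- The vertices of the pentagon {01}–{23}–{04}–{12}–{34} of P.  Since P has
-- girth 5, the edges of P joining two of them are exactly the five
-- pentagon edges.
inPentagon : Fin 10 → Bool
inPentagon i = any (_≐ₑ lookup petersenVerts i)
  ((# 0 , # 1) ∷ (# 2 , # 3) ∷ (# 0 , # 4) ∷ (# 1 , # 2) ∷ (# 3 , # 4) ∷ [])

pentagonWeight : Vector ℕ 15
pentagonWeight e = if inPentagon (proj₁ (ends e)) ∧ inPentagon (proj₂ (ends e)) then 1 else 0

pentagonWeight-odd : ¬ 2 ∣ sum pentagonWeight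
pentagonWeight-odd = from-no (2 ∣? sum pentagonWeight)

L-adj : Fin 15 → Fin 15 → Bool
L-adj x y = not (x == y) ∧ shareVertex (ends x) (ends y)

L-adj-correct : ∀ x y → adj L x y ≡ L-adj x y
L-adj-correct x y = refl

-- Every triangle of L has even weight: the triangles of L are the stars of
-- the vertices of P, and a star meets the pentagon in 0 or 2 edges.
pentagonWeight-triangles : ∀ x y z → L-adj x y ≡ true → L-adj y z ≡ true → L-adj x z ≡ true →
                           2 ∣ pentagonWeight x + pentagonWeight y + pentagonWeight z
pentagonWeight-triangles = from-yes (all? λ x → all? λ y → all? λ z →
  (L-adj x y Bool.≟ true) →-dec (L-adj y z Bool.≟ true) →-dec (L-adj x z Bool.≟ true) →-dec
  (2 ∣? pentagonWeight x + pentagonWeight y + pentagonWeight z))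

-- The three edges of P at the vertex {01} form a triangle of L.
L-triangle : Triangle L zero (# 1) (# 2)
L-triangle = refl , refl , refl

L-not-uniformlyVertexTransitive : ¬ UniformlyVertexTransitive L
L-not-uniformlyVertexTransitive =
  triangle-parity-obstruction L pentagonWeight even-triangles pentagonWeight-odd zero (# 1) (# 2) L-triangle
  where
  even-triangles : ∀ x y z → Triangle L x y z → 2 ∣ pentagonWeight x + pentagonWeight y + pentagonWeight z
  even-triangles x y z (xy , yz , xz) = pentagonWeight-triangles x y z
    (trans (sym (L-adj-correct x y)) xy) (trans (sym (L-adj-correct y z)) yz) (trans (sym (L-adj-correct x z)) xz)

corollary3p7 : VertexTransitive (LineGraph Petersen) × ¬ UniformlyVertexTransitive (LineGraph Petersen)
corollary3p7 = L-vertexTransitive , L-not-uniformlyVertexTransitive
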